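{- Let $n\ge 1$, $1\le k\le n$, $S_n(k):=\{\pi\in S_n : \pi(n)=k\}$, and ${\varepsilon}\in\{1,-1\}$. Then $$\sum_{\pi\in S_n(k)} {\varepsilon}^{{\rm inv}(\pi)}\, q^{{\rm maj}(\pi)} = f_{n-1}({\varepsilon},q,1)\cdot({\varepsilon}^{n-1}q)^{n-k} = \left(\prod_{i=1}^{n-1}[i]_{{\varepsilon}^{i-1}q}\right)\cdot({\varepsilon}^{n-1}q)^{n-k},$$ where $f_{n-1}({\varepsilon},q,1)=\sum_{\sigma\in S_{n-1}}{\varepsilon}^{{\rm inv}(\sigma)}q^{{\rm maj}(\sigma)}$.
   Context: $S_n$ is the symmetric group on $\{1,\dots,n\}$ in one-line notation ($S_0$ has one element, the empty permutation). ${\rm inv}$ is the inversion number, ${\rm maj}(\pi)=\sum\{\,i:\pi(i)>\pi(i+1)\,\}$ the major index. For $m\ge1$, $f_m(x,y,z):=\sum_{\sigma\in S_m}x^{{\rm inv}(\sigma)}y^{{\rm maj}(\sigma)}z^{\sigma(m)-1}$, with $f_0:=1$. For a positive integer $j$, $[j]_t := 1+t+\cdots+t^{j-1}$. -}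

module Defs where

open import Level using (Level)
open import Data.Bool using (Bool; true; false; if_then_else_; _∧_; not)
open import Data.Nat using (ℕ; zero; suc; _∸_; _<ᵇ_; _≡ᵇ_)
open import Data.Nat as N using ()
open import Data.List using (List; []; _∷_; [_]; map; concatMap; filter; foldr; upTo; length)
open import Relation.Nullary.Decidable using (T?)
open import Algebra.Bundles using (CommutativeRing)

words : ℕ → ℕ → List (List ℕ)
words n zero    = [ [] ]
words n (suc m) = concatMap (λ w → map (λ a → a ∷ w) (map suc (upTo n))) (words n m)

notIn : ℕ → List ℕ → Bool
notIn a []       = true
notIn a (b ∷ bs) = not (a ≡ᵇ b) ∧ notIn a bs

distinct : List ℕ → Bool
distinct []       = true
distinct (a ∷ as) = notIn a as ∧ distinct as

-- S n : all permutations of {1,…,n} in one-line notation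
-- (injective words of length n over {1,…,n}); S 0 = [ [] ].
S : ℕ → List (List ℕ)
S n = filter (λ w → T? (distinct w)) (words n n)

-- last entry π(n) (0 for the empty word; never used there)
lastEntry : List ℕ → ℕ
lastEntry []           = 0
lastEntry (a ∷ [])     = a
lastEntry (a ∷ b ∷ bs) = lastEntry (b ∷ bs)

Sk : ℕ → ℕ → List (List ℕ)
Sk n k = filter (λ w → T? (lastEntry w ≡ᵇ k)) (S n)

countLess : ℕ → List ℕ → ℕ
countLess a []       = 0
countLess a (b ∷ bs) = (if b <ᵇ a then 1 else 0) N.+ countLess a bs

inv : List ℕ → ℕ
inv []       = 0
inv (a ∷ as) = countLess a as N.+ inv as

majFrom : ℕ → List ℕ → ℕ
majFrom i []           = 0
majFrom i (a ∷ [])     = 0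
majFrom i (a ∷ b ∷ bs) = (if b <ᵇ a then i else 0) N.+ majFrom (suc i) (b ∷ bs)

maj : List ℕ → ℕ
maj = majFrom 1

module RingDefs {c ℓ : Level} (R : CommutativeRing c ℓ) where
  open CommutativeRing R

  infixr 8 _^_
  _^_ : Carrier → ℕ → Carrier
  x ^ zero  = 1#
  x ^ suc n = x * (x ^ n)

  sumL : List Carrier → Carrier
  sumL = foldr _+_ 0#

  f : ℕ → Carrier → Carrier → Carrier → Carrier
  f zero    x y z = 1#
  f (suc m) x y z =
    sumL (map (λ σ → (x ^ inv σ) * ((y ^ maj σ) * (z ^ (lastEntry σ ∸ 1)))) (S (suc m)))

  qint : ℕ → Carrier → Carrier
  qint j t = sumL (map (λ i → t ^ i) (upTo j))

  prodFrom1 : ℕ → (ℕ → Carrier) → Carrier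
  prodFrom1 zero    g = 1#
  prodFrom1 (suc m) g = prodFrom1 m g * g (suc m)

  lhs : ℕ → ℕ → Carrier → Carrier → Carrier
  lhs n k ε q = sumL (map (λ π → (ε ^ inv π) * (q ^ maj π)) (Sk n k))

module Submission where

open import Defs
open import Level using (Level)
open import Data.Nat using (ℕ; _≤_; _∸_)
open import Data.Product using (_×_)
open import Data.Sum using (_⊎_)
open import Algebra.Bundles using (CommutativeRing)

open import Data.Nat as N using (zero; suc; _<_; _≡ᵇ_; _<ᵇ_; z≤n; s≤s; pred)
import Data.Nat.Properties as NP
open import Data.Nat.Tactic.RingSolver using (solve-∀)
open import Data.Bool using (Bool; true; false; if_then_else_; _∧_; not)
open import Data.Bool.Properties using (∧-assoc; ∧-commutativeMonoid)
open import Data.List using (List; []; _∷_; [_]; _++_; map; length; upTo; applyUpTo; concat; filter)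
open import Data.List.Properties using (length-map)
open import Data.List.Relation.Unary.All as All using (All; []; _∷_)
open import Data.Product using (_,_; proj₁; proj₂; Σ)
open import Data.Sum using (inj₁; inj₂)
open import Data.Empty using (⊥-elim)
open import Relation.Nullary.Decidable using (T?)
import Relation.Binary.PropositionalEquality as ≡
open ≡ using (_≡_; _≢_)
open import Algebra.Bundles using (CommutativeMonoid; Ring)
import Algebra.Properties.Ring as RingProperties

-- Let c be the cycle of {1,…,n} sending 1 to n and every other x to x − 1. For
-- k ≥ 1, π ↦ c ∘ π maps S_n(k+1) onto S_n(k), and turns the letter 1 of π into the
-- largest letter: maj grows by exactly one, and inv changes by n − 1 − 2d, where d
-- is the number of letters before 1. As ε² = 1, the weight ε^inv q^maj is thus
-- multiplied by ε^(n−1) q. The elements of S_n(n) are the permutations of S_(n−1)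
-- followed by n, which adds neither inversions nor descents; iterating gives the
-- first equality. Summing it over k gives f_n = f_(n−1) · [n]_(ε^(n−1) q), whence
-- the product formula. Sums over S_n are computed as sums over all words of length
-- n over {1,…,n} weighted by the indicator of distinctness, a set on which c acts
-- letter by letter.

module Words where
  open ≡ using (refl; sym; trans; cong; cong₂; subst; module ≡-Reasoning)
  open import Algebra.Properties.CommutativeSemigroup
    (CommutativeMonoid.commutativeSemigroup ∧-commutativeMonoid) using (interchange)

  open N using (_+_)

  ∧-true⁻ : ∀ {a b} → a ∧ b ≡ true → a ≡ true × b ≡ true
  ∧-true⁻ {true} {true} _ = refl , refl

  ∧-true : ∀ {a b} → a ≡ true → b ≡ true → a ∧ b ≡ true
  ∧-true refl refl = refl

  ≡ᵇ-refl : ∀ m → (m ≡ᵇ m) ≡ true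
  ≡ᵇ-refl zero    = refl
  ≡ᵇ-refl (suc m) = ≡ᵇ-refl m

  ≡ᵇ-sym : ∀ a b → (a ≡ᵇ b) ≡ (b ≡ᵇ a)
  ≡ᵇ-sym zero    zero    = refl
  ≡ᵇ-sym zero    (suc b) = refl
  ≡ᵇ-sym (suc a) zero    = refl
  ≡ᵇ-sym (suc a) (suc b) = ≡ᵇ-sym a b

  ≡ᵇ-true⇒≡ : ∀ {a b} → (a ≡ᵇ b) ≡ true → a ≡ b
  ≡ᵇ-true⇒≡ {zero}  {zero}  _ = refl
  ≡ᵇ-true⇒≡ {suc a} {suc b} e = cong suc (≡ᵇ-true⇒≡ e)

  ≢⇒≡ᵇ-false : ∀ {a b} → a ≢ b → (a ≡ᵇ b) ≡ false
  ≢⇒≡ᵇ-false {zero}  {zero}  a≢b = ⊥-elim (a≢b refl)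
  ≢⇒≡ᵇ-false {zero}  {suc b} _   = refl
  ≢⇒≡ᵇ-false {suc a} {zero}  _   = refl
  ≢⇒≡ᵇ-false {suc a} {suc b} a≢b = ≢⇒≡ᵇ-false (λ e → a≢b (cong suc e))

  ≡ᵇ-false⇒≢ : ∀ {a b} → (a ≡ᵇ b) ≡ false → a ≢ b
  ≡ᵇ-false⇒≢ {a} e refl with () ← trans (sym e) (≡ᵇ-refl a)

  <⇒<ᵇ-true : ∀ {a b} → a < b → (a <ᵇ b) ≡ true
  <⇒<ᵇ-true {zero}  (s≤s _)   = refl
  <⇒<ᵇ-true {suc a} (s≤s a<b) = <⇒<ᵇ-true a<b

  ≥⇒<ᵇ-false : ∀ {a b} → b ≤ a → (a <ᵇ b) ≡ false
  ≥⇒<ᵇ-false {a}     {zero}  _       = refl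
  ≥⇒<ᵇ-false {suc a} {suc b} (s≤s p) = ≥⇒<ᵇ-false p

  distinct-head : ∀ x xs → distinct (x ∷ xs) ≡ true → notIn x xs ≡ true
  distinct-head x xs e = proj₁ (∧-true⁻ {notIn x xs} e)

  distinct-tail : ∀ x xs → distinct (x ∷ xs) ≡ true → distinct xs ≡ true
  distinct-tail x xs e = proj₂ (∧-true⁻ {notIn x xs} e)

  notIn-head : ∀ a x xs → notIn a (x ∷ xs) ≡ true → (a ≡ᵇ x) ≡ false
  notIn-head a x xs e with a ≡ᵇ x | proj₁ (∧-true⁻ {not (a ≡ᵇ x)} e)
  ... | false | _ = refl

  notIn-tail : ∀ a x xs → notIn a (x ∷ xs) ≡ true → notIn a xs ≡ true
  notIn-tail a x xs e = proj₂ (∧-true⁻ {not (a ≡ᵇ x)} e)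

  lastEntry-All : ∀ {P : ℕ → Set} a as → All P (a ∷ as) → P (lastEntry (a ∷ as))
  lastEntry-All a []       (pa ∷ _) = pa
  lastEntry-All a (b ∷ bs) (_ ∷ ps) = lastEntry-All b bs ps

  lastEntry-map : ∀ (f : ℕ → ℕ) a as → lastEntry (map f (a ∷ as)) ≡ f (lastEntry (a ∷ as))
  lastEntry-map f a []       = refl
  lastEntry-map f a (b ∷ bs) = lastEntry-map f b bs

  Letter : ℕ → ℕ → Set
  Letter n x = 1 ≤ x × x ≤ n

  Letter≥2 : ℕ → ℕ → Set
  Letter≥2 n x = 2 ≤ x × x ≤ n

  notIn1⇒All≥2 : ∀ {n} w → All (Letter n) w → notIn 1 w ≡ true → All (Letter≥2 n) w
  notIn1⇒All≥2 []                []            _ = []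
  notIn1⇒All≥2 (suc zero ∷ w)    (_ ∷ ls)      ()
  notIn1⇒All≥2 (suc (suc x) ∷ w) ((_ , x≤n) ∷ ls) e = (s≤s (s≤s z≤n) , x≤n) ∷ notIn1⇒All≥2 w ls e

  rotate : ℕ → ℕ → ℕ
  rotate n x = if x ≡ᵇ 1 then n else x ∸ 1

  rotate-≡ᵇ : ∀ {n} a b → Letter n a → Letter n b → (rotate n a ≡ᵇ rotate n b) ≡ (a ≡ᵇ b)
  rotate-≡ᵇ {n} (suc zero)    (suc zero)    _         _         = ≡ᵇ-refl n
  rotate-≡ᵇ     (suc zero)    (suc (suc b)) _         (_ , b<n) = ≢⇒≡ᵇ-false (λ e → NP.<-irrefl (sym e) b<n)
  rotate-≡ᵇ     (suc (suc a)) (suc zero)    (_ , a<n) _         = ≢⇒≡ᵇ-false (λ e → NP.<-irrefl e a<n)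
  rotate-≡ᵇ     (suc (suc a)) (suc (suc b)) _         _         = refl

  notIn-rotate : ∀ {n} a as → Letter n a → All (Letter n) as →
                 notIn (rotate n a) (map (rotate n) as) ≡ notIn a as
  notIn-rotate a []       _  []        = refl
  notIn-rotate a (b ∷ as) la (lb ∷ ls) = cong₂ _∧_ (cong not (rotate-≡ᵇ a b la lb)) (notIn-rotate a as la ls)

  distinct-rotate : ∀ {n} w → All (Letter n) w → distinct (map (rotate n) w) ≡ distinct w
  distinct-rotate []      []        = refl
  distinct-rotate (a ∷ w) (la ∷ ls) = cong₂ _∧_ (notIn-rotate a w la ls) (distinct-rotate w ls)

  rotate-≡ᵇ-pred : ∀ {n} x k → Letter n x → 1 ≤ k → k < n → (rotate n x ≡ᵇ k) ≡ (x ≡ᵇ suc k)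
  rotate-≡ᵇ-pred (suc zero)    (suc k) _ _ k<n = ≢⇒≡ᵇ-false (λ e → NP.<-irrefl (sym e) k<n)
  rotate-≡ᵇ-pred (suc (suc x)) k       _ _ _   = refl

  -- Inversions under rotation

  countLess-rotate-≥2 : ∀ {n} a as → All (Letter≥2 n) as →
                        countLess (suc a) (map (rotate n) as) ≡ countLess (suc (suc a)) as
  countLess-rotate-≥2 a []                 []                  = refl
  countLess-rotate-≥2 a (suc zero ∷ as)    ((s≤s () , _) ∷ _)
  countLess-rotate-≥2 a (suc (suc b) ∷ as) (_ ∷ ls) =
    cong ((if b <ᵇ a then 1 else 0) +_) (countLess-rotate-≥2 a as ls)

  countLess-top-rotate : ∀ {n} as → All (Letter≥2 n) as → countLess n (map (rotate n) as) ≡ length as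
  countLess-top-rotate []                 []                        = refl
  countLess-top-rotate (suc zero ∷ as)    ((s≤s () , _) ∷ _)
  countLess-top-rotate {n} (suc (suc b) ∷ as) ((_ , s≤s b<n) ∷ ls)
    rewrite <⇒<ᵇ-true {suc b} {n} (s≤s b<n) = cong suc (countLess-top-rotate as ls)

  countLess-1 : ∀ as → All (1 ≤_) as → countLess 1 as ≡ 0
  countLess-1 []             []       = refl
  countLess-1 (suc b ∷ as) (_ ∷ ps) = countLess-1 as ps

  countLess-rotate : ∀ {n} a as → suc (suc a) ≤ n → All (Letter n) as → distinct as ≡ true →
                     notIn 1 as ≡ false →
                     suc (countLess (suc a) (map (rotate n) as)) ≡ countLess (suc (suc a)) as
  countLess-rotate a [] _ _ _ ()
  countLess-rotate {n} a (suc zero ∷ bs) (s≤s a<n) (_ ∷ ls) d _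
    rewrite ≥⇒<ᵇ-false {n} {suc a} (NP.≤-trans (NP.n≤1+n _) (s≤s a<n)) =
    cong suc (countLess-rotate-≥2 a bs (notIn1⇒All≥2 bs ls (distinct-head 1 bs d)))
  countLess-rotate a (suc (suc b) ∷ bs) a<n (_ ∷ ls) d 1∈bs =
    trans (sym (NP.+-suc (if b <ᵇ a then 1 else 0) _))
          (cong ((if b <ᵇ a then 1 else 0) +_)
                (countLess-rotate a bs a<n ls (distinct-tail (suc (suc b)) bs d) 1∈bs))

  inv-rotate-≥2 : ∀ {n} w → All (Letter≥2 n) w → inv (map (rotate n) w) ≡ inv w
  inv-rotate-≥2 []                []                 = refl
  inv-rotate-≥2 (suc zero ∷ w)    ((s≤s () , _) ∷ _)
  inv-rotate-≥2 (suc (suc a) ∷ w) (_ ∷ ls) = cong₂ _+_ (countLess-rotate-≥2 a w ls) (inv-rotate-≥2 w ls)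

  -- The letter 1, preceded by d letters, becomes n, followed by length w ∸ 1 ∸ d
  -- letters; all other pairs keep their relative order.
  inv-rotate : ∀ {n} w → All (Letter n) w → distinct w ≡ true → notIn 1 w ≡ false →
               Σ ℕ λ d → inv (map (rotate n) w) + (d + d) ≡ inv w + (length w ∸ 1)
  inv-rotate [] _ _ ()
  inv-rotate {n} (suc zero ∷ as) (_ ∷ ls) d _ = 0 , (begin
    countLess n (map (rotate n) as) + inv (map (rotate n) as) + 0
      ≡⟨ cong₂ (λ x y → x + y + 0) (countLess-top-rotate as ≥2) (inv-rotate-≥2 as ≥2) ⟩
    length as + inv as + 0
      ≡⟨ swap (length as) (inv as) ⟩
    0 + inv as + length as
      ≡˘⟨ cong (λ x → x + inv as + length as) (countLess-1 as (All.map proj₁ ls)) ⟩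
    countLess 1 as + inv as + length as ∎)
    where
    open ≡-Reasoning
    ≥2 = notIn1⇒All≥2 as ls (distinct-head 1 as d)
    swap : ∀ x y → x + y + 0 ≡ 0 + y + x
    swap = solve-∀
  inv-rotate (suc (suc a) ∷ []) _ _ ()
  inv-rotate {n} (suc (suc a) ∷ b ∷ bs) ((_ , a<n) ∷ ls) d 1∈w
    with inv-rotate {n} (b ∷ bs) ls (distinct-tail (suc (suc a)) (b ∷ bs) d) 1∈w
  ... | e , ih = suc e , (begin
    C + I′ + (suc e + suc e)        ≡⟨ regroupˡ C I′ e ⟩
    suc (suc C) + (I′ + (e + e))    ≡⟨ cong (suc (suc C) +_) ih ⟩
    suc (suc C) + (I + length bs)   ≡⟨ regroupʳ C I (length bs) ⟩
    suc C + I + suc (length bs)     ≡⟨ cong (λ x → x + I + suc (length bs))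
                                         (countLess-rotate a (b ∷ bs) a<n ls (distinct-tail (suc (suc a)) (b ∷ bs) d) 1∈w) ⟩
    countLess (suc (suc a)) (b ∷ bs) + I + suc (length bs) ∎)
    where
    open ≡-Reasoning
    C  = countLess (suc a) (map (rotate n) (b ∷ bs))
    I′ = inv (map (rotate n) (b ∷ bs))
    I  = inv (b ∷ bs)
    regroupˡ : ∀ x y z → x + y + (suc z + suc z) ≡ suc (suc x) + (y + (z + z))
    regroupˡ = solve-∀
    regroupʳ : ∀ x y z → suc (suc x) + (y + z) ≡ suc x + y + suc z
    regroupʳ = solve-∀

  -- The major index under rotation

  majFrom-rotate-≥2 : ∀ {n} i w → All (Letter≥2 n) w → majFrom i (map (rotate n) w) ≡ majFrom i w
  majFrom-rotate-≥2 i []                                 []                      = refl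
  majFrom-rotate-≥2 i (suc zero ∷ _)                     ((s≤s () , _) ∷ _)
  majFrom-rotate-≥2 i (suc (suc a) ∷ [])                 _                       = refl
  majFrom-rotate-≥2 i (suc (suc a) ∷ suc zero ∷ bs)      (_ ∷ (s≤s () , _) ∷ _)
  majFrom-rotate-≥2 i (suc (suc a) ∷ suc (suc b) ∷ bs)   (_ ∷ ls) =
    cong ((if b <ᵇ a then i else 0) +_) (majFrom-rotate-≥2 (suc i) (suc (suc b) ∷ bs) ls)

  majFrom-rotate-1∷ : ∀ {n} i b bs → All (Letter≥2 n) (b ∷ bs) →
                      majFrom i (map (rotate n) (1 ∷ b ∷ bs)) ≡ i + majFrom i (1 ∷ b ∷ bs)
  majFrom-rotate-1∷ i (suc zero) bs ((s≤s () , _) ∷ _)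
  majFrom-rotate-1∷ {n} i (suc (suc b)) bs (lb@(_ , s≤s b<n) ∷ ls)
    rewrite <⇒<ᵇ-true {suc b} {n} (s≤s b<n) =
    cong (i +_) (majFrom-rotate-≥2 (suc i) (suc (suc b) ∷ bs) (lb ∷ ls))

  majFrom-rotate-∷ : ∀ {n} i a b bs → suc (suc a) ≤ n → All (Letter n) (b ∷ bs) →
                     distinct (b ∷ bs) ≡ true → notIn 1 (b ∷ bs) ≡ false → lastEntry (b ∷ bs) ≢ 1 →
                     majFrom i (map (rotate n) (suc (suc a) ∷ b ∷ bs)) ≡ suc (majFrom i (suc (suc a) ∷ b ∷ bs))
  majFrom-rotate-∷ i a (suc zero) [] _ _ _ _ last≢1 = ⊥-elim (last≢1 refl)
  majFrom-rotate-∷ {n} i a (suc zero) (c ∷ cs) (s≤s a<n) (_ ∷ ls) d _ _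
    rewrite ≥⇒<ᵇ-false {n} {suc a} (NP.≤-trans (NP.n≤1+n _) (s≤s a<n)) =
    majFrom-rotate-1∷ (suc i) c cs (notIn1⇒All≥2 (c ∷ cs) ls (distinct-head 1 (c ∷ cs) d))
  majFrom-rotate-∷ i a (suc (suc b)) [] _ _ _ () _
  majFrom-rotate-∷ i a (suc (suc b)) (c ∷ cs) _ ((_ , b<n) ∷ ls) d 1∈w last≢1 =
    trans (cong ((if b <ᵇ a then i else 0) +_)
                (majFrom-rotate-∷ (suc i) b c cs b<n ls (distinct-tail (suc (suc b)) (c ∷ cs) d) 1∈w last≢1))
          (NP.+-suc (if b <ᵇ a then i else 0) _)

  -- Only the descents around the letter 1 change: one at its left disappears and
  -- one at its right (present because 1 is not last) appears.
  maj-rotate : ∀ {n} w → All (Letter n) w → distinct w ≡ true → notIn 1 w ≡ false → lastEntry w ≢ 1 →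
               maj (map (rotate n) w) ≡ suc (maj w)
  maj-rotate [] _ _ () _
  maj-rotate (suc zero ∷ [])           _                 _ _   last≢1 = ⊥-elim (last≢1 refl)
  maj-rotate (suc zero ∷ b ∷ bs)       (_ ∷ ls)          d _   _      =
    majFrom-rotate-1∷ 1 b bs (notIn1⇒All≥2 (b ∷ bs) ls (distinct-head 1 (b ∷ bs) d))
  maj-rotate (suc (suc a) ∷ [])        _                 _ ()  _
  maj-rotate (suc (suc a) ∷ b ∷ bs)    ((_ , a<n) ∷ ls)  d 1∈w last≢1 =
    majFrom-rotate-∷ 1 a b bs a<n ls (distinct-tail (suc (suc a)) (b ∷ bs) d) 1∈w last≢1

  -- Pigeonhole

  removeAll : ℕ → List ℕ → List ℕ
  removeAll t []       = []
  removeAll t (x ∷ xs) = if x ≡ᵇ t then removeAll t xs else x ∷ removeAll t xs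

  removeAll-notIn : ∀ t xs → notIn t xs ≡ true → removeAll t xs ≡ xs
  removeAll-notIn t []       _ = refl
  removeAll-notIn t (x ∷ xs) e
    rewrite ≡ᵇ-sym x t | notIn-head t x xs e = cong (x ∷_) (removeAll-notIn t xs (notIn-tail t x xs e))

  notIn-removeAll : ∀ a t xs → notIn a xs ≡ true → notIn a (removeAll t xs) ≡ true
  notIn-removeAll a t []       _ = refl
  notIn-removeAll a t (x ∷ xs) e with x ≡ᵇ t
  ... | true  = notIn-removeAll a t xs (notIn-tail a x xs e)
  ... | false = ∧-true (proj₁ (∧-true⁻ {not (a ≡ᵇ x)} e)) (notIn-removeAll a t xs (notIn-tail a x xs e))

  distinct-removeAll : ∀ t xs → distinct xs ≡ true → distinct (removeAll t xs) ≡ true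
  distinct-removeAll t []       _ = refl
  distinct-removeAll t (x ∷ xs) d with x ≡ᵇ t
  ... | true  = distinct-removeAll t xs (distinct-tail x xs d)
  ... | false = ∧-true (notIn-removeAll x t xs (distinct-head x xs d)) (distinct-removeAll t xs (distinct-tail x xs d))

  length-removeAll : ∀ t xs → distinct xs ≡ true → length xs ≤ suc (length (removeAll t xs))
  length-removeAll t []       _ = z≤n
  length-removeAll t (x ∷ xs) d with x ≡ᵇ t in x≡ᵇt
  ... | true rewrite ≡ᵇ-true⇒≡ {x} {t} x≡ᵇt | removeAll-notIn t xs (distinct-head t xs d) = NP.≤-refl
  ... | false = s≤s (length-removeAll t xs (distinct-tail x xs d))

  removeAll-Letter : ∀ m xs → All (Letter (suc m)) xs → All (Letter m) (removeAll (suc m) xs)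
  removeAll-Letter m []       []                 = []
  removeAll-Letter m (x ∷ xs) ((1≤x , x≤m+1) ∷ ls) with x ≡ᵇ suc m in x≡ᵇm+1
  ... | true  = removeAll-Letter m xs ls
  ... | false = (1≤x , NP.≤-pred (NP.≤∧≢⇒< x≤m+1 (≡ᵇ-false⇒≢ x≡ᵇm+1))) ∷ removeAll-Letter m xs ls

  distinct⇒length≤ : ∀ m w → distinct w ≡ true → All (Letter m) w → length w ≤ m
  distinct⇒length≤ zero    []      _ []                  = z≤n
  distinct⇒length≤ zero    (_ ∷ _) _ ((s≤s _ , ()) ∷ _)
  distinct⇒length≤ (suc m) w       d ls = NP.≤-trans (length-removeAll (suc m) w d)
    (s≤s (distinct⇒length≤ m (removeAll (suc m) w) (distinct-removeAll (suc m) w d) (removeAll-Letter m w ls)))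

  notIn-pred : ∀ a as → All (1 ≤_) as → 1 ≤ a → notIn (pred a) (map pred as) ≡ notIn a as
  notIn-pred a       []           []       _ = refl
  notIn-pred (suc a) (suc b ∷ as) (_ ∷ ps) p = cong (not (a ≡ᵇ b) ∧_) (notIn-pred (suc a) as ps p)

  distinct-pred : ∀ w → All (1 ≤_) w → distinct (map pred w) ≡ distinct w
  distinct-pred []      []       = refl
  distinct-pred (a ∷ w) (p ∷ ps) = cong₂ _∧_ (notIn-pred a w ps p) (distinct-pred w ps)

  Letter≥2-pred : ∀ {n} w → All (Letter≥2 n) w → All (Letter (pred n)) (map pred w)
  Letter≥2-pred []                []                      = []
  Letter≥2-pred (suc zero ∷ w)    ((s≤s () , _) ∷ _)
  Letter≥2-pred (suc (suc x) ∷ w) ((_ , s≤s x<n) ∷ ls) = (s≤s z≤n , x<n) ∷ Letter≥2-pred w ls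

  permutation-contains-1 : ∀ {n} w → All (Letter n) w → length w ≡ n → 1 ≤ n → distinct w ≡ true →
                           notIn 1 w ≡ false
  permutation-contains-1 {suc n} w ls len _ d with notIn 1 w in 1∉w
  ... | false = refl
  ... | true  = ⊥-elim (NP.<-irrefl refl (subst (_≤ n) (trans (length-map pred w) len)
                  (distinct⇒length≤ n (map pred w) distinct-w′ (Letter≥2-pred w ≥2))))
    where
    ≥2 = notIn1⇒All≥2 w ls 1∉w
    distinct-w′ = trans (distinct-pred w (All.map (λ l → NP.<⇒≤ (proj₁ l)) ≥2)) d

  -- Appending the largest letter

  lastEntry-++ : ∀ v a → lastEntry (v ++ [ a ]) ≡ a
  lastEntry-++ []          a = refl
  lastEntry-++ (x ∷ [])    a = refl
  lastEntry-++ (x ∷ y ∷ v) a = lastEntry-++ (y ∷ v) a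

  notIn-++ : ∀ x xs a → notIn x (xs ++ [ a ]) ≡ notIn x xs ∧ not (x ≡ᵇ a)
  notIn-++ x []       a with x ≡ᵇ a
  ... | true  = refl
  ... | false = refl
  notIn-++ x (y ∷ xs) a rewrite notIn-++ x xs a = sym (∧-assoc (not (x ≡ᵇ y)) (notIn x xs) (not (x ≡ᵇ a)))

  distinct-++ : ∀ v a → distinct (v ++ [ a ]) ≡ distinct v ∧ notIn a v
  distinct-++ []       a = refl
  distinct-++ (x ∷ xs) a rewrite notIn-++ x xs a | distinct-++ xs a | ≡ᵇ-sym x a =
    interchange (notIn x xs) (not (a ≡ᵇ x)) (distinct xs) (notIn a xs)

  countLess-++-≥ : ∀ n a v → a ≤ n → countLess a (v ++ [ n ]) ≡ countLess a v
  countLess-++-≥ n a []      a≤n rewrite ≥⇒<ᵇ-false {n} {a} a≤n = refl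
  countLess-++-≥ n a (x ∷ v) a≤n = cong ((if x <ᵇ a then 1 else 0) +_) (countLess-++-≥ n a v a≤n)

  inv-++-max : ∀ n v → All (Letter n) v → inv (v ++ [ n ]) ≡ inv v
  inv-++-max n []      []               = refl
  inv-++-max n (x ∷ v) ((_ , x≤n) ∷ ls) = cong₂ _+_ (countLess-++-≥ n x v x≤n) (inv-++-max n v ls)

  majFrom-++-max : ∀ n i v → All (Letter n) v → majFrom i (v ++ [ n ]) ≡ majFrom i v
  majFrom-++-max n i []          []                = refl
  majFrom-++-max n i (x ∷ [])    ((_ , x≤n) ∷ []) rewrite ≥⇒<ᵇ-false {n} {x} x≤n = refl
  majFrom-++-max n i (x ∷ y ∷ v) (_ ∷ ls)        =
    cong ((if y <ᵇ x then i else 0) +_) (majFrom-++-max n (suc i) (y ∷ v) ls)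

open Words

module WordSums {c ℓ : Level} (R : CommutativeRing c ℓ) where
  open CommutativeRing R hiding (zero)
  open RingDefs R
  open import Relation.Binary.Reasoning.Setoid setoid
  open import Algebra.Properties.CommutativeSemigroup +-commutativeSemigroup using (interchange)

  sumUpTo : (ℕ → Carrier) → ℕ → Carrier
  sumUpTo f zero    = 0#
  sumUpTo f (suc n) = sumUpTo f n + f n

  sumL-++ : ∀ {A : Set} (g : A → Carrier) xs ys →
            sumL (map g (xs ++ ys)) ≈ sumL (map g xs) + sumL (map g ys)
  sumL-++ g []       ys = sym (+-identityˡ _)
  sumL-++ g (x ∷ xs) ys = trans (+-congˡ (sumL-++ g xs ys)) (sym (+-assoc _ _ _))

  sumL-concat : ∀ {A : Set} (g : A → Carrier) xss →
                sumL (map g (concat xss)) ≈ sumL (map (λ xs → sumL (map g xs)) xss)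
  sumL-concat g []         = refl
  sumL-concat g (xs ∷ xss) = trans (sumL-++ g xs (concat xss)) (+-congˡ (sumL-concat g xss))

  sumL-cong : ∀ {A : Set} (g h : A → Carrier) xs → (∀ x → g x ≈ h x) → sumL (map g xs) ≈ sumL (map h xs)
  sumL-cong g h []       _   = refl
  sumL-cong g h (x ∷ xs) g≈h = +-cong (g≈h x) (sumL-cong g h xs g≈h)

  *-distribˡ-sumL : ∀ {A : Set} a (g : A → Carrier) xs → sumL (map (λ x → a * g x) xs) ≈ a * sumL (map g xs)
  *-distribˡ-sumL a g []       = sym (zeroʳ a)
  *-distribˡ-sumL a g (x ∷ xs) = trans (+-congˡ (*-distribˡ-sumL a g xs)) (sym (distribˡ a _ _))

  sumL-filter : ∀ {A : Set} (b : A → Bool) (g : A → Carrier) xs →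
                sumL (map g (filter (λ x → T? (b x)) xs)) ≈ sumL (map (λ x → if b x then g x else 0#) xs)
  sumL-filter b g []       = refl
  sumL-filter b g (x ∷ xs) with b x
  ... | true  = +-congˡ (sumL-filter b g xs)
  ... | false = trans (sumL-filter b g xs) (sym (+-identityˡ _))

  sumUpTo-cong : ∀ (f g : ℕ → Carrier) n → (∀ i → i < n → f i ≈ g i) → sumUpTo f n ≈ sumUpTo g n
  sumUpTo-cong f g zero    _   = refl
  sumUpTo-cong f g (suc n) f≈g = +-cong (sumUpTo-cong f g n (λ i i<n → f≈g i (NP.m≤n⇒m≤1+n i<n))) (f≈g n NP.≤-refl)

  sumUpTo-zero : ∀ (f : ℕ → Carrier) n → (∀ i → i < n → f i ≈ 0#) → sumUpTo f n ≈ 0#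
  sumUpTo-zero f zero    _    = refl
  sumUpTo-zero f (suc n) f≈0 =
    trans (+-cong (sumUpTo-zero f n (λ i i<n → f≈0 i (NP.m≤n⇒m≤1+n i<n))) (f≈0 n NP.≤-refl)) (+-identityˡ 0#)

  sumUpTo-head : ∀ (f : ℕ → Carrier) n → sumUpTo f (suc n) ≈ f 0 + sumUpTo (λ i → f (suc i)) n
  sumUpTo-head f zero    = trans (+-identityˡ _) (sym (+-identityʳ _))
  sumUpTo-head f (suc n) = trans (+-congʳ (sumUpTo-head f n)) (+-assoc _ _ _)

  sumUpTo-distrib-+ : ∀ (f g : ℕ → Carrier) n → sumUpTo (λ i → f i + g i) n ≈ sumUpTo f n + sumUpTo g n
  sumUpTo-distrib-+ f g zero    = sym (+-identityˡ 0#)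
  sumUpTo-distrib-+ f g (suc n) = trans (+-congʳ (sumUpTo-distrib-+ f g n)) (interchange _ _ _ _)

  *-distribˡ-sumUpTo : ∀ a (f : ℕ → Carrier) n → sumUpTo (λ i → a * f i) n ≈ a * sumUpTo f n
  *-distribˡ-sumUpTo a f zero    = sym (zeroʳ a)
  *-distribˡ-sumUpTo a f (suc n) = trans (+-congʳ (*-distribˡ-sumUpTo a f n)) (sym (distribˡ a _ _))

  sumUpTo-comm : ∀ (h : ℕ → ℕ → Carrier) a b →
                 sumUpTo (λ i → sumUpTo (h i) a) b ≈ sumUpTo (λ j → sumUpTo (λ i → h i j) b) a
  sumUpTo-comm h a zero    = sym (sumUpTo-zero (λ _ → 0#) a (λ _ _ → refl))
  sumUpTo-comm h a (suc b) = trans (+-congʳ (sumUpTo-comm h a b))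
                                   (sym (sumUpTo-distrib-+ (λ j → sumUpTo (λ i → h i j) b) (h b) a))

  sumUpTo-sumL-comm : ∀ {A : Set} (g : ℕ → A → Carrier) n xs →
                      sumUpTo (λ i → sumL (map (g i) xs)) n ≈ sumL (map (λ x → sumUpTo (λ i → g i x) n) xs)
  sumUpTo-sumL-comm g n []       = sumUpTo-zero _ n (λ _ _ → refl)
  sumUpTo-sumL-comm g n (x ∷ xs) = trans (sumUpTo-distrib-+ (λ i → g i x) (λ i → sumL (map (g i) xs)) n)
                                         (+-congˡ (sumUpTo-sumL-comm g n xs))

  sumUpTo-reverse : ∀ (f : ℕ → Carrier) n → sumUpTo (λ i → f (n ∸ suc i)) n ≈ sumUpTo f n
  sumUpTo-reverse f zero    = refl
  sumUpTo-reverse f (suc n) = trans (sumUpTo-head (λ i → f (suc n ∸ suc i)) n)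
                                    (trans (+-congˡ (sumUpTo-reverse f n)) (+-comm _ _))

  sumL-map-applyUpTo : ∀ (h : ℕ → Carrier) (f : ℕ → ℕ) n →
                       sumL (map h (applyUpTo f n)) ≈ sumUpTo (λ i → h (f i)) n
  sumL-map-applyUpTo h f zero    = refl
  sumL-map-applyUpTo h f (suc n) = trans (+-congˡ (sumL-map-applyUpTo h (λ i → f (suc i)) n))
                                         (sym (sumUpTo-head (λ i → h (f i)) n))

  sumUpTo-indicator : ∀ n a x → Letter n a → sumUpTo (λ i → if a ≡ᵇ suc i then x else 0#) n ≈ x
  sumUpTo-indicator zero    (suc a) x (_ , ())
  sumUpTo-indicator (suc n) a       x (1≤a , a≤n+1) with a ≡ᵇ suc n in a≡ᵇn+1
  ... | true  = trans (+-congʳ (sumUpTo-zero _ n others)) (+-identityˡ x)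
    where
    others : ∀ i → i < n → (if a ≡ᵇ suc i then x else 0#) ≈ 0#
    others i i<n rewrite ≡ᵇ-true⇒≡ {a} a≡ᵇn+1 | ≢⇒≡ᵇ-false {n} {i} (λ e → NP.<-irrefl (≡.sym e) i<n) = refl
  ... | false = trans (+-identityʳ _)
                      (sumUpTo-indicator n a x (1≤a , NP.≤-pred (NP.≤∧≢⇒< a≤n+1 (≡ᵇ-false⇒≢ a≡ᵇn+1))))

  ^-distribˡ-+-* : ∀ x a b → x ^ (a N.+ b) ≈ x ^ a * x ^ b
  ^-distribˡ-+-* x zero    b = sym (*-identityˡ _)
  ^-distribˡ-+-* x (suc a) b = trans (*-congˡ (^-distribˡ-+-* x a b)) (sym (*-assoc _ _ _))

  ^-zeroˡ : ∀ k → 1# ^ k ≈ 1#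
  ^-zeroˡ zero    = refl
  ^-zeroˡ (suc k) = trans (*-identityˡ _) (^-zeroˡ k)

  if-0# : ∀ b → (if b then 0# else 0#) ≈ 0#
  if-0# true  = refl
  if-0# false = refl

  Word : ℕ → ℕ → List ℕ → Set
  Word n m w = All (Letter n) w × length w ≡ m

  sumWords : ℕ → ℕ → (List ℕ → Carrier) → Carrier
  sumWords n m g = sumL (map g (words n m))

  sumWords-suc : ∀ n m (g : List ℕ → Carrier) →
                 sumWords n (suc m) g ≈ sumWords n m (λ w → sumUpTo (λ i → g (suc i ∷ w)) n)
  sumWords-suc n m g = trans (sumL-concat g (map extensions (words n m))) (perWord (words n m))
    where
    extensions : List ℕ → List (List ℕ)
    extensions w = map (λ a → a ∷ w) (map suc (upTo n))
    sumExtensions : ∀ w (f : ℕ → ℕ) k →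
      sumL (map g (map (λ a → a ∷ w) (map suc (applyUpTo f k)))) ≈ sumUpTo (λ i → g (suc (f i) ∷ w)) k
    sumExtensions w f zero    = refl
    sumExtensions w f (suc k) = trans (+-congˡ (sumExtensions w (λ i → f (suc i)) k))
                                      (sym (sumUpTo-head (λ i → g (suc (f i) ∷ w)) k))
    perWord : ∀ ws → sumL (map (λ xs → sumL (map g xs)) (map extensions ws))
                     ≈ sumL (map (λ w → sumUpTo (λ i → g (suc i ∷ w)) n) ws)
    perWord []       = refl
    perWord (w ∷ ws) = +-cong (sumExtensions w (λ i → i) n) (perWord ws)

  sumWords-cong : ∀ n m (g h : List ℕ → Carrier) → (∀ w → Word n m w → g w ≈ h w) →
                  sumWords n m g ≈ sumWords n m h
  sumWords-cong n zero    g h g≈h = +-congʳ (g≈h [] ([] , ≡.refl))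
  sumWords-cong n (suc m) g h g≈h = begin
    sumWords n (suc m) g                                ≈⟨ sumWords-suc n m g ⟩
    sumWords n m (λ w → sumUpTo (λ i → g (suc i ∷ w)) n) ≈⟨ sumWords-cong n m _ _ extend ⟩
    sumWords n m (λ w → sumUpTo (λ i → h (suc i ∷ w)) n) ≈⟨ sumWords-suc n m h ⟨
    sumWords n (suc m) h                                ∎
    where
    extend : ∀ w → Word n m w → sumUpTo (λ i → g (suc i ∷ w)) n ≈ sumUpTo (λ i → h (suc i ∷ w)) n
    extend w (ls , len) = sumUpTo-cong _ _ n (λ i i<n → g≈h (suc i ∷ w) ((s≤s z≤n , i<n) ∷ ls , ≡.cong suc len))

  sumUpTo-rotate : ∀ n (h : ℕ → Carrier) → sumUpTo (λ i → h (rotate n (suc i))) n ≈ sumUpTo (λ i → h (suc i)) n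
  sumUpTo-rotate zero    h = refl
  sumUpTo-rotate (suc n) h = trans (sumUpTo-head (λ i → h (rotate (suc n) (suc i))) n) (+-comm _ _)

  sumWords-rotate : ∀ n m (g : List ℕ → Carrier) → sumWords n m (λ w → g (map (rotate n) w)) ≈ sumWords n m g
  sumWords-rotate n zero    g = refl
  sumWords-rotate n (suc m) g = begin
    sumWords n (suc m) (λ w → g (map (rotate n) w))                                ≈⟨ sumWords-suc n m _ ⟩
    sumWords n m (λ w → sumUpTo (λ i → g (rotate n (suc i) ∷ map (rotate n) w)) n)
      ≈⟨ sumWords-cong n m _ _ (λ w _ → sumUpTo-rotate n (λ a → g (a ∷ map (rotate n) w))) ⟩
    sumWords n m (λ w → G (map (rotate n) w))                                      ≈⟨ sumWords-rotate n m G ⟩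
    sumWords n m G                                                                 ≈⟨ sumWords-suc n m g ⟨
    sumWords n (suc m) g                                                           ∎
    where
    G : List ℕ → Carrier
    G v = sumUpTo (λ i → g (suc i ∷ v)) n

  sumWords-++ : ∀ n m (g : List ℕ → Carrier) →
                sumWords n (suc m) g ≈ sumWords n m (λ v → sumUpTo (λ i → g (v ++ [ suc i ])) n)
  sumWords-++ n zero    g = sumWords-suc n zero g
  sumWords-++ n (suc m) g = begin
    sumWords n (suc (suc m)) g                                                     ≈⟨ sumWords-suc n (suc m) g ⟩
    sumWords n (suc m) (λ u → sumUpTo (λ j → g (suc j ∷ u)) n)                     ≈⟨ sumWords-++ n m _ ⟩
    sumWords n m (λ v → sumUpTo (λ i → sumUpTo (λ j → g (suc j ∷ v ++ [ suc i ])) n) n)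
      ≈⟨ sumWords-cong n m _ _ (λ v _ → sumUpTo-comm (λ i j → g (suc j ∷ v ++ [ suc i ])) n n) ⟩
    sumWords n m (λ v → sumUpTo (λ j → sumUpTo (λ i → g (suc j ∷ v ++ [ suc i ])) n) n)
      ≈⟨ sumWords-suc n m (λ u → sumUpTo (λ i → g (u ++ [ suc i ])) n) ⟨
    sumWords n (suc m) (λ u → sumUpTo (λ i → g (u ++ [ suc i ])) n)               ∎

  sumWords-notIn : ∀ n m (h : List ℕ → Carrier) →
                   sumWords (suc n) m (λ v → if notIn (suc n) v then h v else 0#) ≈ sumWords n m h
  sumWords-notIn n zero    h = refl
  sumWords-notIn n (suc m) h = begin
    sumWords (suc n) (suc m) (λ v → if notIn (suc n) v then h v else 0#)          ≈⟨ sumWords-suc (suc n) m _ ⟩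
    sumWords (suc n) m (λ w → sumUpTo (λ i → if notIn (suc n) (suc i ∷ w) then h (suc i ∷ w) else 0#) (suc n))
      ≈⟨ sumWords-cong (suc n) m _ _ (λ w _ → dropTop w) ⟩
    sumWords (suc n) m (λ w → if notIn (suc n) w then H w else 0#)               ≈⟨ sumWords-notIn n m H ⟩
    sumWords n m H                                                               ≈⟨ sumWords-suc n m h ⟨
    sumWords n (suc m) h                                                         ∎
    where
    H : List ℕ → Carrier
    H w = sumUpTo (λ i → h (suc i ∷ w)) n
    dropTop : ∀ w → sumUpTo (λ i → if notIn (suc n) (suc i ∷ w) then h (suc i ∷ w) else 0#) (suc n)
                    ≈ (if notIn (suc n) w then H w else 0#)
    dropTop w rewrite ≡ᵇ-refl n = trans (+-identityʳ _) (trans (sumUpTo-cong _ _ n below) (pull (notIn (suc n) w)))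
      where
      below : ∀ i → i < n → (if notIn (suc n) (suc i ∷ w) then h (suc i ∷ w) else 0#)
                            ≈ (if notIn (suc n) w then h (suc i ∷ w) else 0#)
      below i i<n rewrite ≢⇒≡ᵇ-false {n} {i} (λ e → NP.<-irrefl (≡.sym e) i<n) = refl
      pull : ∀ b → sumUpTo (λ i → if b then h (suc i ∷ w) else 0#) n ≈ (if b then H w else 0#)
      pull true  = refl
      pull false = sumUpTo-zero _ n (λ _ _ → refl)

  module SignedPermutationSums (ε q : Carrier) (ε*ε≈1 : ε * ε ≈ 1#) where

    open import Algebra.Properties.CommutativeSemigroup *-commutativeSemigroup using ()
      renaming (interchange to *-interchange)

    weight : List ℕ → Carrier
    weight w = ε ^ inv w * q ^ maj w

    permWeight : List ℕ → Carrier
    permWeight w = if distinct w then weight w else 0#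

    weightEndingAt : ℕ → List ℕ → Carrier
    weightEndingAt k w = if distinct w then (if lastEntry w ≡ᵇ k then weight w else 0#) else 0#

    permSum : ℕ → Carrier
    permSum m = sumL (map weight (S m))

    permSum≈sumWords : ∀ m → permSum m ≈ sumWords m m permWeight
    permSum≈sumWords m = sumL-filter distinct weight (words m m)

    lhs≈sumWords : ∀ n k → lhs n k ε q ≈ sumWords n n (weightEndingAt k)
    lhs≈sumWords n k = trans (sumL-filter (λ w → lastEntry w ≡ᵇ k) weight (S n))
                             (sumL-filter distinct (λ w → if lastEntry w ≡ᵇ k then weight w else 0#) (words n n))

    ε^[d+d]≈1 : ∀ d → ε ^ (d N.+ d) ≈ 1#
    ε^[d+d]≈1 zero    = refl
    ε^[d+d]≈1 (suc d) rewrite NP.+-suc d d = begin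
      ε * (ε * ε ^ (d N.+ d)) ≈⟨ *-assoc _ _ _ ⟨
      (ε * ε) * ε ^ (d N.+ d) ≈⟨ *-cong ε*ε≈1 (ε^[d+d]≈1 d) ⟩
      1# * 1#                 ≈⟨ *-identityˡ _ ⟩
      1#                      ∎

    ε^inv-rotate : ∀ n w → Word n n w → distinct w ≡ true → 1 ≤ n →
                   ε ^ inv (map (rotate n) w) ≈ ε ^ (n ∸ 1) * ε ^ inv w
    ε^inv-rotate n w (ls , len) dw n≥1 with inv-rotate w ls dw (permutation-contains-1 w ls len n≥1 dw)
    ... | d , inv-eq = begin
      ε ^ inv w′                      ≈⟨ *-identityʳ _ ⟨
      ε ^ inv w′ * 1#                 ≈⟨ *-congˡ (ε^[d+d]≈1 d) ⟨
      ε ^ inv w′ * ε ^ (d N.+ d)      ≈⟨ ^-distribˡ-+-* ε (inv w′) (d N.+ d) ⟨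
      ε ^ (inv w′ N.+ (d N.+ d))      ≡⟨ ≡.cong (ε ^_) inv-eq ⟩
      ε ^ (inv w N.+ (length w ∸ 1))  ≡⟨ ≡.cong (λ l → ε ^ (inv w N.+ (l ∸ 1))) len ⟩
      ε ^ (inv w N.+ (n ∸ 1))         ≈⟨ ^-distribˡ-+-* ε (inv w) (n ∸ 1) ⟩
      ε ^ inv w * ε ^ (n ∸ 1)         ≈⟨ *-comm _ _ ⟩
      ε ^ (n ∸ 1) * ε ^ inv w         ∎
      where
      w′ = map (rotate n) w

    weight-rotate : ∀ n w → Word n n w → distinct w ≡ true → lastEntry w ≢ 1 → 1 ≤ n →
                    weight (map (rotate n) w) ≈ (ε ^ (n ∸ 1) * q) * weight w
    weight-rotate n w word@(ls , len) dw last≢1 n≥1 = begin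
      ε ^ inv (map (rotate n) w) * q ^ maj (map (rotate n) w)
        ≈⟨ *-cong (ε^inv-rotate n w word dw n≥1)
                  (reflexive (≡.cong (q ^_) (maj-rotate w ls dw (permutation-contains-1 w ls len n≥1 dw) last≢1))) ⟩
      (ε ^ (n ∸ 1) * ε ^ inv w) * (q * q ^ maj w)
        ≈⟨ *-interchange _ _ _ _ ⟩
      (ε ^ (n ∸ 1) * q) * (ε ^ inv w * q ^ maj w) ∎

    weightEndingAt-rotate : ∀ n k w → 1 ≤ k → k < n → Word n n w →
                            weightEndingAt k (map (rotate n) w) ≈ (ε ^ (n ∸ 1) * q) * weightEndingAt (suc k) w
    weightEndingAt-rotate n k [] _ () ([] , ≡.refl)
    weightEndingAt-rotate n k (a ∷ as) k≥1 k<n word@(ls , _)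
      rewrite distinct-rotate (a ∷ as) ls | lastEntry-map (rotate n) a as
            | rotate-≡ᵇ-pred (lastEntry (a ∷ as)) k (lastEntry-All a as ls) k≥1 k<n
      with distinct (a ∷ as) in dw | lastEntry (a ∷ as) ≡ᵇ suc k in ends
    ... | true  | true  = weight-rotate n (a ∷ as) word dw last≢1 (NP.≤-trans (s≤s z≤n) k<n)
      where
      last≢1 : lastEntry (a ∷ as) ≢ 1
      last≢1 e with () ← ≡.subst (1 ≤_) (NP.suc-injective (≡.trans (≡.sym (≡ᵇ-true⇒≡ ends)) e)) k≥1
    ... | true  | false = sym (zeroʳ _)
    ... | false | _     = sym (zeroʳ _)

    lhs-step : ∀ n k → 1 ≤ k → k < n → lhs n k ε q ≈ (ε ^ (n ∸ 1) * q) * lhs n (suc k) ε q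
    lhs-step n k k≥1 k<n = begin
      lhs n k ε q                                                ≈⟨ lhs≈sumWords n k ⟩
      sumWords n n (weightEndingAt k)                            ≈⟨ sumWords-rotate n n (weightEndingAt k) ⟨
      sumWords n n (λ w → weightEndingAt k (map (rotate n) w))
        ≈⟨ sumWords-cong n n _ _ (λ w → weightEndingAt-rotate n k w k≥1 k<n) ⟩
      sumWords n n (λ w → (ε ^ (n ∸ 1) * q) * weightEndingAt (suc k) w)
        ≈⟨ *-distribˡ-sumL _ (weightEndingAt (suc k)) (words n n) ⟩
      (ε ^ (n ∸ 1) * q) * sumWords n n (weightEndingAt (suc k))  ≈⟨ *-congˡ (lhs≈sumWords n (suc k)) ⟨
      (ε ^ (n ∸ 1) * q) * lhs n (suc k) ε q                      ∎

    weight-++-max : ∀ n v → All (Letter n) v → weight (v ++ [ n ]) ≈ weight v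
    weight-++-max n v ls rewrite inv-++-max n v ls | majFrom-++-max n 1 v ls = refl

    lhs-top : ∀ m → lhs (suc m) (suc m) ε q ≈ permSum m
    lhs-top m = begin
      lhs (suc m) (suc m) ε q                        ≈⟨ lhs≈sumWords (suc m) (suc m) ⟩
      sumWords (suc m) (suc m) (weightEndingAt (suc m)) ≈⟨ sumWords-++ (suc m) m (weightEndingAt (suc m)) ⟩
      sumWords (suc m) m (λ v → sumUpTo (λ i → weightEndingAt (suc m) (v ++ [ suc i ])) (suc m))
        ≈⟨ sumWords-cong (suc m) m _ _ (λ v (ls , _) → onlyTop v ls) ⟩
      sumWords (suc m) m (λ v → if notIn (suc m) v then permWeight v else 0#) ≈⟨ sumWords-notIn m m permWeight ⟩
      sumWords m m permWeight                        ≈⟨ permSum≈sumWords m ⟨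
      permSum m                                      ∎
      where
      notTop : ∀ v i → i < m → weightEndingAt (suc m) (v ++ [ suc i ]) ≈ 0#
      notTop v i i<m rewrite lastEntry-++ v (suc i) | ≢⇒≡ᵇ-false {i} {m} (λ e → NP.<-irrefl e i<m) = if-0# _
      top : ∀ v → All (Letter (suc m)) v →
            weightEndingAt (suc m) (v ++ [ suc m ]) ≈ (if notIn (suc m) v then permWeight v else 0#)
      top v ls rewrite lastEntry-++ v (suc m) | ≡ᵇ-refl m | distinct-++ v (suc m)
        with distinct v | notIn (suc m) v
      ... | true  | true  = weight-++-max (suc m) v ls
      ... | true  | false = refl
      ... | false | true  = refl
      ... | false | false = refl
      onlyTop : ∀ v → All (Letter (suc m)) v →
                sumUpTo (λ i → weightEndingAt (suc m) (v ++ [ suc i ])) (suc m)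
                ≈ (if notIn (suc m) v then permWeight v else 0#)
      onlyTop v ls = trans (+-congʳ (sumUpTo-zero _ m (notTop v))) (trans (+-identityˡ _) (top v ls))

    lhs-from-top : ∀ m d → d ≤ m → lhs (suc m) (suc m ∸ d) ε q ≈ permSum m * (ε ^ m * q) ^ d
    lhs-from-top m zero    _   = trans (lhs-top m) (sym (*-identityʳ _))
    lhs-from-top m (suc d) d<m = begin
      lhs (suc m) (m ∸ d) ε q              ≈⟨ lhs-step (suc m) (m ∸ d) (NP.m<n⇒0<n∸m d<m) (s≤s (NP.m∸n≤m m d)) ⟩
      t * lhs (suc m) (suc (m ∸ d)) ε q    ≡⟨ ≡.cong (λ k → t * lhs (suc m) k ε q) (≡.sym (NP.+-∸-assoc 1 d≤m)) ⟩
      t * lhs (suc m) (suc m ∸ d) ε q      ≈⟨ *-congˡ (lhs-from-top m d d≤m) ⟩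
      t * (permSum m * t ^ d)              ≈⟨ *-assoc _ _ _ ⟨
      (t * permSum m) * t ^ d              ≈⟨ *-congʳ (*-comm _ _) ⟩
      (permSum m * t) * t ^ d              ≈⟨ *-assoc _ _ _ ⟩
      permSum m * (t * t ^ d)              ∎
      where
      t = ε ^ m * q
      d≤m = NP.<⇒≤ d<m

    lhs≈permSum* : ∀ m k → 1 ≤ k → k ≤ suc m → lhs (suc m) k ε q ≈ permSum m * (ε ^ m * q) ^ (suc m ∸ k)
    lhs≈permSum* m (suc k) _ k≤m = ≡.subst (λ k′ → lhs (suc m) k′ ε q ≈ permSum m * (ε ^ m * q) ^ (m ∸ k))
                                     (NP.m∸[m∸n]≡n k≤m) (lhs-from-top m (m ∸ k) (NP.m∸n≤m m k))

    permSum≈sumUpTo-lhs : ∀ m → permSum (suc m) ≈ sumUpTo (λ i → lhs (suc m) (suc i) ε q) (suc m)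
    permSum≈sumUpTo-lhs m = begin
      permSum n                                            ≈⟨ permSum≈sumWords n ⟩
      sumWords n n permWeight                              ≈⟨ sumWords-cong n n _ _ byLastEntry ⟩
      sumWords n n (λ w → sumUpTo (λ i → weightEndingAt (suc i) w) n)
        ≈⟨ sumUpTo-sumL-comm (λ i → weightEndingAt (suc i)) n (words n n) ⟨
      sumUpTo (λ i → sumWords n n (weightEndingAt (suc i))) n
        ≈⟨ sumUpTo-cong _ _ n (λ i _ → sym (lhs≈sumWords n (suc i))) ⟩
      sumUpTo (λ i → lhs n (suc i) ε q) n                   ∎
      where
      n = suc m
      byLastEntry : ∀ w → Word n n w → permWeight w ≈ sumUpTo (λ i → weightEndingAt (suc i) w) n
      byLastEntry []       (_ , ())
      byLastEntry (a ∷ as) (ls , _) with distinct (a ∷ as)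
      ... | true  = sym (sumUpTo-indicator n (lastEntry (a ∷ as)) (weight (a ∷ as)) (lastEntry-All a as ls))
      ... | false = sym (sumUpTo-zero _ n (λ _ _ → refl))

    permSum-suc : ∀ m → permSum (suc m) ≈ permSum m * qint (suc m) (ε ^ m * q)
    permSum-suc m = begin
      permSum n                                        ≈⟨ permSum≈sumUpTo-lhs m ⟩
      sumUpTo (λ i → lhs n (suc i) ε q) n              ≈⟨ sumUpTo-cong _ _ n (λ i i<n → lhs≈permSum* m (suc i) (s≤s z≤n) i<n) ⟩
      sumUpTo (λ i → permSum m * t ^ (n ∸ suc i)) n    ≈⟨ *-distribˡ-sumUpTo (permSum m) _ n ⟩
      permSum m * sumUpTo (λ i → t ^ (n ∸ suc i)) n    ≈⟨ *-congˡ (sumUpTo-reverse (t ^_) n) ⟩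
      permSum m * sumUpTo (t ^_) n                     ≈⟨ *-congˡ (sumL-map-applyUpTo (t ^_) (λ i → i) n) ⟨
      permSum m * qint n t                             ∎
      where
      n = suc m
      t = ε ^ m * q

    f≈permSum : ∀ m → f m ε q 1# ≈ permSum m
    f≈permSum zero    = sym (trans (+-identityʳ _) (*-identityˡ _))
    f≈permSum (suc m) = sumL-cong _ _ (S (suc m))
      (λ σ → *-congˡ (trans (*-congˡ (^-zeroˡ (lastEntry σ ∸ 1))) (*-identityʳ _)))

    permSum≈prod : ∀ m → permSum m ≈ prodFrom1 m (λ i → qint i (ε ^ (i ∸ 1) * q))
    permSum≈prod zero    = trans (+-identityʳ _) (*-identityˡ _)
    permSum≈prod (suc m) = trans (permSum-suc m) (*-congʳ (permSum≈prod m))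
±1*±1≈1 : ∀ {c ℓ} (R : Ring c ℓ) → let open Ring R in ∀ {ε} → ε ≈ 1# ⊎ ε ≈ - 1# → ε * ε ≈ 1#
±1*±1≈1 R (inj₁ ε≈1)  = trans (*-cong ε≈1 ε≈1) (*-identityˡ 1#)
  where open Ring R
±1*±1≈1 R (inj₂ ε≈-1) = trans (*-cong ε≈-1 ε≈-1) (trans (-1*x≈-x (- 1#)) (-‿involutive 1#))
  where open Ring R
        open RingProperties R

corollary3p4 : {c ℓ : Level} (R : CommutativeRing c ℓ) →
    let open CommutativeRing R
        open RingDefs R
    in (n k : ℕ) → 1 ≤ n → 1 ≤ k → k ≤ n →
       (ε q : Carrier) → (ε ≈ 1# ⊎ ε ≈ - 1#) →
       (lhs n k ε q ≈ f (n ∸ 1) ε q 1# * ((ε ^ (n ∸ 1)) * q) ^ (n ∸ k))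
       × (f (n ∸ 1) ε q 1# * ((ε ^ (n ∸ 1)) * q) ^ (n ∸ k)
          ≈ prodFrom1 (n ∸ 1) (λ i → qint i ((ε ^ (i ∸ 1)) * q)) * ((ε ^ (n ∸ 1)) * q) ^ (n ∸ k))
corollary3p4 R (suc m) k _ k≥1 k≤n ε q ε≈±1 =
  trans (lhs≈permSum* m k k≥1 k≤n) (*-congʳ (sym (f≈permSum m))) ,
  *-congʳ (trans (f≈permSum m) (permSum≈prod m))
  where
  open CommutativeRing R
  open WordSums R
  open SignedPermutationSums ε q (±1*±1≈1 ring ε≈±1)
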